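{- Let ${\cal D}=(V,{\cal B})$ be a BIBD$(v,k,1)$ whose block set ${\cal B}$ contains a parallel class $\pi$. Then there exists a $k$-GDD ${\cal D}_\pi$ of type $k^{v/k}$ such that \[\chi({\cal D})\ge\chi({\cal D}_\pi)\ge\chi({\cal D})-\left\lceil\frac{v}{k(k-1)}\right\rceil.\]
   Context: A BIBD$(v,k,1)$ is a pair $(V,{\cal B})$ with $|V|=v$ and ${\cal B}$ a collection of $k$-subsets (blocks) of $V$ such that every pair of distinct points lies in exactly one block. A parallel class is a set of $v/k$ blocks partitioning $V$. A $k$-GDD of type $g^u$ is a triple $(V,{\cal G},{\cal B})$ where ${\cal G}$ partitions $V$ into $u$ groups of size $g$ and ${\cal B}$ is a collection of $k$-subsets (blocks) such that every pair of distinct points lies in exactly one block or in exactly one group, but not both. A weak $c$-colouring is a map from the points to $c$ colours with no monochromatic block; the chromatic number $\chi$ is the least such $c$. -}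

module Defs where

open import Data.Nat using (ℕ; zero; suc; _+_; _*_; _∸_; _≤_)
open import Data.Nat.DivMod using (_/_)
open import Data.Bool using (Bool; true; false; _∧_; if_then_else_)
open import Data.Fin using (Fin)
open import Data.Fin.Subset using (Subset; _∈_; ∣_∣)
open import Data.Vec using (lookup)
open import Data.List using (List; []; _∷_; length)
open import Data.List.Membership.Propositional renaming (_∈_ to _∈ₗ_)
open import Data.List.Relation.Unary.All using (All)
open import Data.Product using (Σ; _×_)
open import Relation.Binary.PropositionalEquality using (_≡_; _≢_)
open import Relation.Nullary using (¬_)

-- number of sets in the list S containing both points x and y
-- (with x = y this is the number of sets containing x)
countPair : ∀ {n} → List (Subset n) → Fin n → Fin n → ℕ
countPair [] x y = 0
countPair (b ∷ S) x y =
  (if lookup b x ∧ lookup b y then 1 else 0) + countPair S x y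

AllOfSize : ∀ {n} → ℕ → List (Subset n) → Set
AllOfSize k S = All (λ b → ∣ b ∣ ≡ k) S

record IsBIBD (v k : ℕ) (B : List (Subset v)) : Set where
  field
    blockSize : AllOfSize k B
    pairs     : ∀ (x y : Fin v) → x ≢ y → countPair B x y ≡ 1

record IsParallelClass {v : ℕ} (B π : List (Subset v)) : Set where
  field
    fromB     : ∀ b → b ∈ₗ π → b ∈ₗ B
    partition : ∀ (x : Fin v) → countPair π x x ≡ 1

record GDD (n k g u : ℕ) : Set where
  field
    groups      : List (Subset n)
    blocks      : List (Subset n)
    numGroups   : length groups ≡ u
    groupSize   : AllOfSize g groups
    groupsPart  : ∀ (x : Fin n) → countPair groups x x ≡ 1
    blockSize   : AllOfSize k blocks
    pairs       : ∀ (x y : Fin n) → x ≢ y →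
                  countPair groups x y + countPair blocks x y ≡ 1

Monochromatic : ∀ {n c} → (Fin n → Fin c) → Subset n → Set
Monochromatic col b = ∀ x y → x ∈ b → y ∈ b → col x ≡ col y

IsWeakColouring : ∀ {n c} → List (Subset n) → (Fin n → Fin c) → Set
IsWeakColouring B col = ∀ b → b ∈ₗ B → ¬ Monochromatic col b

Colourable : ∀ {n} → List (Subset n) → ℕ → Set
Colourable {n} B c = Σ (Fin n → Fin c) (IsWeakColouring B)

IsChromaticNumber : ∀ {n} → List (Subset n) → ℕ → Set
IsChromaticNumber B χ = Colourable B χ × (∀ c → Colourable B c → χ ≤ c)

-- ⌈ a / d ⌉ (value 0 when d = 0; only used with d ≥ 1)
ceilDiv : ℕ → ℕ → ℕ
ceilDiv a zero    = 0
ceilDiv a (suc d) = (a + d) / suc d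

-- Deleting the blocks of π leaves a k-GDD whose groups are the blocks of π, so every weak
-- colouring of the design also colours the GDD.  Conversely, start from an optimal colouring
-- of the GDD, number its u = v/k groups, and recolour the least point of each group with a
-- fresh colour shared by k - 1 consecutive groups, which needs ⌈u/(k-1)⌉ = ⌈v/(k(k-1))⌉ new
-- colours.  Every group then sees an old and a new colour.  A block of the GDD containing an
-- old colour stays non-monochromatic; a block all of whose k points were recoloured meets k
-- distinct groups, which cannot all lie in one batch of k - 1.
module Submission where

open import Defs
open import Data.Nat using (ℕ; zero; suc; _+_; _*_; _∸_; _≤_; _<_; _≟_; _<?_; z≤n; s≤s; s≤s⁻¹; z<s; NonZero)
open import Data.Nat.Properties
open import Data.Nat.DivMod using (_/_; _%_; m≡m%n+[m/n]*n; m%n<n; m<n*o⇒m/o<n)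
open import Data.Nat.Induction using (<-rec)
open import Data.Bool using (true; false; _∧_; if_then_else_)
import Data.Bool as Bool
open import Data.Fin using (Fin; zero; suc; toℕ; _↑ˡ_; _↑ʳ_; fromℕ<; punchOut; inject)
import Data.Fin.Properties as Finₚ
open import Data.Fin.Subset using (Subset; _∈_; ∣_∣)
open import Data.Fin.Subset.Properties using (_∈?_)
open import Data.Vec using ([]; _∷_; lookup; here; there)
open import Data.Vec.Properties using (≡-dec; []=⇒lookup; lookup⇒[]=)
open import Data.Vec.Functional as Vector using (head; tail)
open import Data.List using (List; []; _∷_; length; filter; _++_)
open import Data.List.Membership.Propositional renaming (_∈_ to _∈ₗ_)
open import Data.List.Membership.Propositional.Properties using (∈-filter⁺; ∈-filter⁻; ∈-++⁺ˡ; ∈-++⁺ʳ; ∈-++⁻)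
import Data.List.Membership.DecPropositional as DecMembership
open import Data.List.Relation.Unary.Any using (here; there; index)
open import Data.List.Relation.Unary.All as All using (All; []; _∷_)
open import Data.List.Relation.Unary.All.Properties using (anti-mono)
open import Data.List.Relation.Binary.Subset.Propositional using (_⊆_)
open import Data.List.Relation.Binary.Subset.Propositional.Properties using (filter-⊆)
open import Data.Product using (Σ; _×_; _,_; proj₂; ∃; ∃-syntax; map₁; map₂)
open import Data.Sum using ([_,_]′)
open import Data.Empty using (⊥-elim)
open import Function using (_∘_)
open import Relation.Nullary using (¬_; Dec; yes; no; ¬?; contradiction)
open import Relation.Nullary.Decidable using (_×-dec_; _→-dec_; map′; decidable-stable)
open import Relation.Unary using (Pred; Decidable)
open import Relation.Unary.Properties using (∁?)
open import Relation.Binary.PropositionalEquality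
open import Relation.Binary.Definitions using (tri<; tri≈; tri>)
open import Algebra.Properties.CommutativeMonoid.Sum +-0-commutativeMonoid using (sum; ∑-distrib-+; sum-cong-≗; sum-replicate-zero)
open import Algebra.Properties.CommutativeSemigroup +-commutativeSemigroup using (x∙yz≈y∙xz)

injection⇒∣p∣≤m : ∀ {n m} (p : Subset n) (f : (x : Fin n) → x ∈ p → Fin m) →
  (∀ x y (x∈p : x ∈ p) (y∈p : y ∈ p) → f x x∈p ≡ f y y∈p → x ≡ y) → ∣ p ∣ ≤ m
injection⇒∣p∣≤m [] f f-inj = z≤n
injection⇒∣p∣≤m (false ∷ p) f f-inj =
  injection⇒∣p∣≤m p (λ x x∈p → f (suc x) (there x∈p))
    (λ x y x∈p y∈p eq → Finₚ.suc-injective (f-inj (suc x) (suc y) (there x∈p) (there y∈p) eq))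
injection⇒∣p∣≤m {m = zero} (true ∷ p) f f-inj with f zero here
... | ()
injection⇒∣p∣≤m {m = suc m} (true ∷ p) f f-inj = s≤s (injection⇒∣p∣≤m p g g-inj)
  where
  f₀≢f : ∀ x (x∈p : x ∈ p) → f zero here ≢ f (suc x) (there x∈p)
  f₀≢f x x∈p eq with f-inj zero (suc x) here (there x∈p) eq
  ... | ()
  g : (x : Fin _) → x ∈ p → Fin m
  g x x∈p = punchOut (f₀≢f x x∈p)
  g-inj : ∀ x y (x∈p : x ∈ p) (y∈p : y ∈ p) → g x x∈p ≡ g y y∈p → x ≡ y
  g-inj x y x∈p y∈p eq = Finₚ.suc-injective (f-inj (suc x) (suc y) (there x∈p) (there y∈p)
    (Finₚ.punchOut-injective (f₀≢f x x∈p) (f₀≢f y y∈p) eq))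

∣p∣>0⇒∃∈ : ∀ {n} (p : Subset n) → 0 < ∣ p ∣ → ∃[ x ] x ∈ p
∣p∣>0⇒∃∈ (true ∷ p) _ = zero , here
∣p∣>0⇒∃∈ (false ∷ p) 0<∣p∣ = let (x , x∈p) = ∣p∣>0⇒∃∈ p 0<∣p∣ in suc x , there x∈p

∣p∣≥2⇒∃∈-≢ : ∀ {n} (p : Subset n) → 2 ≤ ∣ p ∣ → (z : Fin n) → ∃[ w ] w ∈ p × w ≢ z
∣p∣≥2⇒∃∈-≢ p 2≤∣p∣ z with Finₚ.any? (λ w → (w ∈? p) ×-dec ¬? (w Finₚ.≟ z))
... | yes found = found
... | no none = ⊥-elim (<⇒≱ 2≤∣p∣ (injection⇒∣p∣≤m p (λ _ _ → zero) all-equal))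
  where
  only-z : ∀ w → w ∈ p → w ≡ z
  only-z w w∈p = decidable-stable (w Finₚ.≟ z) (λ w≢z → none (w , w∈p , w≢z))
  all-equal : ∀ x y → x ∈ p → y ∈ p → _ → x ≡ y
  all-equal x y x∈p y∈p _ = trans (only-z x x∈p) (sym (only-z y y∈p))

module _ {n : ℕ} where

  countPair-pos⇒∃ : ∀ (S : List (Subset n)) x y → 0 < countPair S x y →
                    ∃[ b ] b ∈ₗ S × x ∈ b × y ∈ b
  countPair-pos⇒∃ (b ∷ S) x y pos with lookup b x in bx | lookup b y in by
  ... | true  | true  = b , here refl , lookup⇒[]= x b bx , lookup⇒[]= y b by
  ... | true  | false = map₂ (map₁ there) (countPair-pos⇒∃ S x y pos)
  ... | false | _     = map₂ (map₁ there) (countPair-pos⇒∃ S x y pos)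

  ∃⇒countPair-pos : ∀ {S : List (Subset n)} {b} x y → b ∈ₗ S → x ∈ b → y ∈ b → 0 < countPair S x y
  ∃⇒countPair-pos {b ∷ S} x y (here refl) x∈b y∈b rewrite []=⇒lookup x∈b | []=⇒lookup y∈b = z<s
  ∃⇒countPair-pos {c ∷ S} x y (there b∈S) x∈b y∈b = ≤-trans (∃⇒countPair-pos x y b∈S x∈b y∈b) (m≤n+m _ _)

  countPair≤countPair-diag : ∀ (S : List (Subset n)) x y → countPair S x y ≤ countPair S x x
  countPair≤countPair-diag [] x y = z≤n
  countPair≤countPair-diag (b ∷ S) x y with lookup b x | lookup b y
  ... | true  | true  = s≤s (countPair≤countPair-diag S x y)
  ... | true  | false = m≤n⇒m≤1+n (countPair≤countPair-diag S x y)
  ... | false | _     = countPair≤countPair-diag S x y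

  countPair-filter : ∀ {ℓ} {P : Pred (Subset n) ℓ} (P? : Decidable P) (S : List (Subset n)) x y →
    countPair S x y ≡ countPair (filter P? S) x y + countPair (filter (∁? P?) S) x y
  countPair-filter P? [] x y = refl
  countPair-filter P? (b ∷ S) x y with P? b
  ... | yes _ = trans (cong (here-count +_) (countPair-filter P? S x y)) (sym (+-assoc here-count _ _))
    where here-count = if lookup b x ∧ lookup b y then 1 else 0
  ... | no _ = trans (cong (here-count +_) (countPair-filter P? S x y))
                     (x∙yz≈y∙xz here-count (countPair (filter P? S) x y) _)
    where here-count = if lookup b x ∧ lookup b y then 1 else 0

  sum-countPair-diag : ∀ {k} (S : List (Subset n)) → AllOfSize k S →
                       sum (λ x → countPair S x x) ≡ length S * k
  sum-countPair-diag [] [] = sum-replicate-zero n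
  sum-countPair-diag (b ∷ S) (∣b∣≡k ∷ sizes) =
    trans (∑-distrib-+ (λ x → if lookup b x ∧ lookup b x then 1 else 0) (λ x → countPair S x x))
          (cong₂ _+_ (trans (sum-indicator b) ∣b∣≡k) (sum-countPair-diag S sizes))
    where
    sum-indicator : ∀ {m} (p : Subset m) → sum (λ x → if lookup p x ∧ lookup p x then 1 else 0) ≡ ∣ p ∣
    sum-indicator [] = refl
    sum-indicator (true ∷ p) = cong suc (sum-indicator p)
    sum-indicator (false ∷ p) = sum-indicator p

  firstIndex : List (Subset n) → Fin n → ℕ
  firstIndex [] x = 0
  firstIndex (b ∷ S) x = if lookup b x then 0 else suc (firstIndex S x)

  ∈⇒firstIndex≡index : ∀ {S : List (Subset n)} {b} x → countPair S x x ≡ 1 →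
                       (b∈S : b ∈ₗ S) → x ∈ b → firstIndex S x ≡ toℕ (index b∈S)
  ∈⇒firstIndex≡index {b ∷ S} x _ (here refl) x∈b rewrite []=⇒lookup x∈b = refl
  ∈⇒firstIndex≡index {c ∷ S} x once (there b∈S) x∈b with lookup c x
  ... | true  = ⊥-elim (<⇒≢ (∃⇒countPair-pos x x b∈S x∈b x∈b) (sym (suc-injective once)))
  ... | false = cong suc (∈⇒firstIndex≡index x once b∈S x∈b)

  firstIndex≡index⇒∈ : ∀ {S : List (Subset n)} {b} z (b∈S : b ∈ₗ S) →
                       firstIndex S z ≡ toℕ (index b∈S) → z ∈ b
  firstIndex≡index⇒∈ {b ∷ S} z (here refl) eq with lookup b z in bz
  ... | true  = lookup⇒[]= z b bz
  ... | false = contradiction eq λ ()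
  firstIndex≡index⇒∈ {c ∷ S} z (there b∈S) eq with lookup c z
  ... | true  = contradiction eq λ ()
  ... | false = firstIndex≡index⇒∈ z b∈S (suc-injective eq)

isWeakColouring-anti-mono : ∀ {n c} {S T : List (Subset n)} {col : Fin n → Fin c} →
                            S ⊆ T → IsWeakColouring T col → IsWeakColouring S col
isWeakColouring-anti-mono S⊆T weak b b∈S = weak b (S⊆T b∈S)

colourable-anti-mono : ∀ {n c} {S T : List (Subset n)} → S ⊆ T → Colourable T c → Colourable S c
colourable-anti-mono S⊆T (col , weak) = col , isWeakColouring-anti-mono S⊆T weak

module _ {n c : ℕ} where

  monochromatic? : (col : Fin n → Fin c) → Decidable (Monochromatic col)
  monochromatic? col b =
    Finₚ.all? λ x → Finₚ.all? λ y → (x ∈? b) →-dec ((y ∈? b) →-dec (col x Finₚ.≟ col y))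

  isWeakColouring? : (S : List (Subset n)) (col : Fin n → Fin c) → Dec (IsWeakColouring S col)
  isWeakColouring? S col =
    map′ (λ all b → All.lookup all) (λ weak → All.tabulate (weak _))
         (All.all? (∁? (monochromatic? col)) S)

anyFunction? : ∀ {c} n {P : (Fin n → Fin c) → Set} →
  (∀ {f g} → (∀ i → f i ≡ g i) → P f → P g) → Decidable P → Dec (∃ P)
anyFunction? zero resp P? = map′ (_ ,_) (λ (f , pf) → resp (λ ()) pf) (P? (λ ()))
anyFunction? (suc n) {P} resp P? =
  map′ (λ (a , g , p) → a Vector.∷ g , p)
       (λ (f , p) → head f , tail f , resp head∷tail p)
       (Finₚ.any? λ a → anyFunction? n {λ g → P (a Vector.∷ g)}
                           (λ eq → resp λ { zero → refl ; (suc i) → eq i }) (P? ∘ (a Vector.∷_)))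
  where
  head∷tail : ∀ {f : Fin (suc n) → _} i → f i ≡ (head f Vector.∷ tail f) i
  head∷tail zero = refl
  head∷tail (suc i) = refl

colourable? : ∀ {n} (S : List (Subset n)) c → Dec (Colourable S c)
colourable? {n} S c = anyFunction? n respects (isWeakColouring? S)
  where
  respects : ∀ {f g} → (∀ i → f i ≡ g i) → IsWeakColouring S f → IsWeakColouring S g
  respects f≗g weak b b∈S mono =
    weak b b∈S λ x y x∈b y∈b → trans (f≗g x) (trans (mono x y x∈b y∈b) (sym (f≗g y)))

IsLeast : (ℕ → Set) → ℕ → Set
IsLeast P m = P m × (∀ c → P c → m ≤ c)

least-witness : ∀ {P : ℕ → Set} → Decidable P → ∀ {n} → P n → ∃ (IsLeast P)
least-witness {P} P? {n} = <-rec (λ n → P n → ∃ (IsLeast P)) search n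
  where
  search : ∀ n → (∀ {m} → m < n → P m → ∃ (IsLeast P)) → P n → ∃ (IsLeast P)
  search n smaller pn with anyUpTo? P? n
  ... | yes (m , m<n , pm) = smaller m<n pm
  ... | no none = n , pn , λ c pc → ≮⇒≥ (λ c<n → none (c , c<n , pc))

chromaticNumber-exists : ∀ {n c} (S : List (Subset n)) → Colourable S c → ∃ (IsChromaticNumber S)
chromaticNumber-exists S = least-witness (colourable? S)

module Leaders {n : ℕ} (label : Fin n → ℕ) where

  IsLeader : Fin n → Set
  IsLeader x = ∀ y → toℕ y < toℕ x → label y ≢ label x

  isLeader? : Decidable IsLeader
  isLeader? x = Finₚ.all? λ y → (toℕ y <? toℕ x) →-dec ¬? (label y ≟ label x)

  leader-unique : ∀ {x y} → IsLeader x → IsLeader y → label x ≡ label y → x ≡ y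
  leader-unique {x} {y} lx ly eq with <-cmp (toℕ x) (toℕ y)
  ... | tri< x<y _ _ = contradiction eq (ly x x<y)
  ... | tri≈ _ x≡y _ = Finₚ.toℕ-injective x≡y
  ... | tri> _ _ y<x = contradiction (sym eq) (lx y y<x)

  leader-exists : ∀ x → ∃[ z ] IsLeader z × label z ≡ label x
  leader-exists x with Finₚ.¬∀⟶∃¬-smallest n (λ y → label y ≢ label x) (λ y → ¬? (label y ≟ label x))
                                                (λ all → all x refl)
  ... | z , ¬z≁x , below-z = z , z-leader , z~x
    where
    z~x : label z ≡ label x
    z~x = decidable-stable (label z ≟ label x) ¬z≁x
    z-leader : IsLeader z
    z-leader y y<z y~z =
      below-z (fromℕ< y<z) (subst (λ w → label w ≡ label x) (sym inject≡y) (trans y~z z~x))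
      where
      inject≡y : inject (fromℕ< y<z) ≡ y
      inject≡y = Finₚ.toℕ-injective (trans (Finₚ.toℕ-inject _) (Finₚ.toℕ-fromℕ< y<z))

/-%-injective : ∀ {a b} d .{{_ : NonZero d}} → a / d ≡ b / d → a % d ≡ b % d → a ≡ b
/-%-injective {a} {b} d a/d≡b/d a%d≡b%d = begin
  a                 ≡⟨ m≡m%n+[m/n]*n a d ⟩
  a % d + a / d * d ≡⟨ cong₂ (λ r q → r + q * d) a%d≡b%d a/d≡b/d ⟩
  b % d + b / d * d ≡⟨ m≡m%n+[m/n]*n b d ⟨
  b                 ∎
  where open ≡-Reasoning

module Recolouring {n m g u c e : ℕ} (D : GDD n (2 + m) g u) (2≤g : 2 ≤ g) (u≤e*[k-1] : u ≤ e * suc m)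
                   (col : Fin n → Fin c) (col-weak : IsWeakColouring (GDD.blocks D) col) where

  open GDD D

  groupOf : ∀ x → ∃[ G ] G ∈ₗ groups × x ∈ G
  groupOf x = let (G , G∈ , x∈G , _) = countPair-pos⇒∃ groups x x (≤-reflexive (sym (groupsPart x))) in
            G , G∈ , x∈G

  groupIndex : Fin n → ℕ
  groupIndex = firstIndex groups

  groupIndex-group : ∀ {G} x (G∈ : G ∈ₗ groups) → x ∈ G → groupIndex x ≡ toℕ (index G∈)
  groupIndex-group x = ∈⇒firstIndex≡index x (groupsPart x)

  groupIndex<u : ∀ x → groupIndex x < u
  groupIndex<u x = let (G , G∈ , x∈G) = groupOf x in
    subst₂ _<_ (sym (groupIndex-group x G∈ x∈G)) numGroups (Finₚ.toℕ<n (index G∈))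

  sameGroupIndex⇒∈ : ∀ {G x y} (G∈ : G ∈ₗ groups) → x ∈ G → groupIndex y ≡ groupIndex x → y ∈ G
  sameGroupIndex⇒∈ {x = x} {y} G∈ x∈G eq = firstIndex≡index⇒∈ y G∈ (trans eq (groupIndex-group x G∈ x∈G))

  block-transversal : ∀ {B x y} → B ∈ₗ blocks → x ∈ B → y ∈ B → x ≢ y → groupIndex x ≢ groupIndex y
  block-transversal {x = x} {y} B∈ x∈B y∈B x≢y eq =
    let (G , G∈ , x∈G) = groupOf x in
    <⇒≱ (+-mono-≤ (∃⇒countPair-pos x y G∈ x∈G (sameGroupIndex⇒∈ G∈ x∈G (sym eq)))
                   (∃⇒countPair-pos x y B∈ x∈B y∈B))
        (≤-reflexive (pairs x y x≢y))

  open Leaders groupIndex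

  newColour<e : ∀ x → groupIndex x / suc m < e
  newColour<e x = m<n*o⇒m/o<n (<-≤-trans (groupIndex<u x) u≤e*[k-1])

  recolour : Fin n → Fin (c + e)
  recolour x with isLeader? x
  ... | yes _ = c ↑ʳ fromℕ< (newColour<e x)
  ... | no _  = col x ↑ˡ e

  recolour-leader : ∀ {x} → IsLeader x → toℕ (recolour x) ≡ c + groupIndex x / suc m
  recolour-leader {x} lx with isLeader? x
  ... | yes _  = trans (Finₚ.toℕ-↑ʳ c _) (cong (c +_) (Finₚ.toℕ-fromℕ< _))
  ... | no ¬lx = contradiction lx ¬lx

  recolour-other : ∀ {x} → ¬ IsLeader x → recolour x ≡ col x ↑ˡ e
  recolour-other {x} ¬lx with isLeader? x
  ... | yes lx = contradiction lx ¬lx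
  ... | no _   = refl

  recolour-other≢leader : ∀ {x y} → ¬ IsLeader x → IsLeader y → recolour x ≢ recolour y
  recolour-other≢leader {x} {y} ¬lx ly eq = <⇒≢ toℕ-old<toℕ-new (begin
    toℕ (col x)              ≡⟨ Finₚ.toℕ-↑ˡ (col x) e ⟨
    toℕ (col x ↑ˡ e)         ≡⟨ cong toℕ (recolour-other ¬lx) ⟨
    toℕ (recolour x)         ≡⟨ cong toℕ eq ⟩
    toℕ (recolour y)         ≡⟨ recolour-leader ly ⟩
    c + groupIndex y / suc m ∎)
    where
    open ≡-Reasoning
    toℕ-old<toℕ-new : toℕ (col x) < c + groupIndex y / suc m
    toℕ-old<toℕ-new = <-≤-trans (Finₚ.toℕ<n (col x)) (m≤m+n c _)

  groups-not-monochromatic : ∀ G → G ∈ₗ groups → ¬ Monochromatic recolour G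
  groups-not-monochromatic G G∈ mono =
    let 2≤∣G∣      = subst (2 ≤_) (sym (All.lookup groupSize G∈)) 2≤g
        (x , x∈G)  = ∣p∣>0⇒∃∈ G (≤-trans (s≤s z≤n) 2≤∣G∣)
        (z , lz , z~x) = leader-exists x
        z∈G        = sameGroupIndex⇒∈ G∈ x∈G z~x
        (w , w∈G , w≢z) = ∣p∣≥2⇒∃∈-≢ G 2≤∣G∣ z
        w~z        = trans (groupIndex-group w G∈ w∈G) (sym (groupIndex-group z G∈ z∈G))
    in recolour-other≢leader (λ lw → w≢z (leader-unique lw lz w~z)) lz (mono w z w∈G z∈G)

  inherits-monochromatic : ∀ {B x} → Monochromatic recolour B → x ∈ B → ¬ IsLeader x → Monochromatic col B
  inherits-monochromatic {B} {x} mono x∈B ¬lx y z y∈B z∈B =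
    trans (same-as-x y y∈B) (sym (same-as-x z z∈B))
    where
    same-as-x : ∀ y → y ∈ B → col y ≡ col x
    same-as-x y y∈B with isLeader? y
    ... | yes ly  = contradiction (mono x y x∈B y∈B) (recolour-other≢leader ¬lx ly)
    ... | no ¬ly = Finₚ.↑ˡ-injective e _ _
                     (trans (sym (recolour-other ¬ly)) (trans (mono y x y∈B x∈B) (recolour-other ¬lx)))

  -- Recoloured points of one colour share groupIndex x / (k-1); the points of a block lie in distinct
  -- groups, so groupIndex x % (k-1) is injective on the block, which is impossible with k points.
  leaders-not-monochromatic : ∀ {B} → B ∈ₗ blocks → Monochromatic recolour B → ¬ (∀ x → x ∈ B → IsLeader x)
  leaders-not-monochromatic {B} B∈ mono leaders =
    <⇒≱ ≤-refl (subst (_≤ suc m) (All.lookup blockSize B∈) (injection⇒∣p∣≤m B residue residue-injective))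
    where
    residue : ∀ x → x ∈ B → Fin (suc m)
    residue x _ = fromℕ< (m%n<n (groupIndex x) (suc m))
    residue-injective : ∀ x y (x∈B : x ∈ B) (y∈B : y ∈ B) → residue x x∈B ≡ residue y y∈B → x ≡ y
    residue-injective x y x∈B y∈B eq with x Finₚ.≟ y
    ... | yes x≡y = x≡y
    ... | no x≢y  = contradiction (/-%-injective (suc m) same-quotient same-residue)
                                  (block-transversal B∈ x∈B y∈B x≢y)
      where
      same-quotient : groupIndex x / suc m ≡ groupIndex y / suc m
      same-quotient = +-cancelˡ-≡ c _ _ (trans (sym (recolour-leader (leaders x x∈B)))
                        (trans (cong toℕ (mono x y x∈B y∈B)) (recolour-leader (leaders y y∈B))))
      same-residue : groupIndex x % suc m ≡ groupIndex y % suc m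
      same-residue = trans (sym (Finₚ.toℕ-fromℕ< _)) (trans (cong toℕ eq) (Finₚ.toℕ-fromℕ< _))

  blocks-not-monochromatic : ∀ B → B ∈ₗ blocks → ¬ Monochromatic recolour B
  blocks-not-monochromatic B B∈ mono with Finₚ.any? (λ x → (x ∈? B) ×-dec ¬? (isLeader? x))
  ... | yes (x , x∈B , ¬lx) = col-weak B B∈ (inherits-monochromatic mono x∈B ¬lx)
  ... | no none = leaders-not-monochromatic B∈ mono
                    (λ x x∈B → decidable-stable (isLeader? x) (λ ¬lx → none (x , x∈B , ¬lx)))

  recolour-weak : IsWeakColouring (groups ++ blocks) recolour
  recolour-weak b b∈ = [ groups-not-monochromatic b , blocks-not-monochromatic b ]′ (∈-++⁻ groups b∈)

gdd-colourable : ∀ {n m g u c e} (D : GDD n (2 + m) g u) → 2 ≤ g → u ≤ e * suc m →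
  Colourable (GDD.blocks D) c → Colourable (GDD.groups D ++ GDD.blocks D) (c + e)
gdd-colourable {e = e} D 2≤g u≤e*[k-1] (col , weak) = recolour , recolour-weak
  where open Recolouring {e = e} D 2≤g u≤e*[k-1] col weak

module ParallelClassGDD {v k : ℕ} {B π : List (Subset v)}
                        (bibd : IsBIBD v k B) (pc : IsParallelClass B π) where

  open IsBIBD bibd
  open IsParallelClass pc

  _∈π? : Decidable (_∈ₗ π)
  b ∈π? = DecMembership._∈?_ (≡-dec Bool._≟_) b π

  B∖π : List (Subset v)
  B∖π = filter (∁? _∈π?) B

  B∖π⊆B : B∖π ⊆ B
  B∖π⊆B = filter-⊆ (∁? _∈π?) B

  B⊆π++B∖π : B ⊆ π ++ B∖π
  B⊆π++B∖π {b} b∈B with b ∈π?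
  ... | yes b∈π = ∈-++⁺ˡ b∈π
  ... | no b∉π  = ∈-++⁺ʳ π (∈-filter⁺ (∁? _∈π?) b∈B b∉π)

  π-size : AllOfSize k π
  π-size = anti-mono (fromB _) blockSize

  |π|*k≡v : length π * k ≡ v
  |π|*k≡v = begin
    length π * k                ≡⟨ sum-countPair-diag π π-size ⟨
    sum (λ x → countPair π x x) ≡⟨ sum-cong-≗ partition ⟩
    sum {v} (λ _ → 1)           ≡⟨ sum-ones v ⟩
    v                           ∎
    where
    open ≡-Reasoning
    sum-ones : ∀ n → sum {n} (λ _ → 1) ≡ n
    sum-ones zero = refl
    sum-ones (suc n) = cong suc (sum-ones n)

  countPair≤1 : ∀ x y → countPair π x y ≤ 1
  countPair≤1 x y = ≤-trans (countPair≤countPair-diag π x y) (≤-reflexive (partition x))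

  countPair-π≡countPair-B∩π : ∀ x y → x ≢ y → countPair π x y ≡ countPair (filter _∈π? B) x y
  countPair-π≡countPair-B∩π x y x≢y =
    ≤1-and-same-positivity⇒≡ (countPair≤1 x y) B∩π≤1 π⇒B∩π B∩π⇒π
    where
    B∩π≤1 : countPair (filter _∈π? B) x y ≤ 1
    B∩π≤1 = ≤-trans (m≤m+n _ _) (≤-reflexive (trans (sym (countPair-filter _∈π? B x y)) (pairs x y x≢y)))
    π⇒B∩π : 0 < countPair π x y → 0 < countPair (filter _∈π? B) x y
    π⇒B∩π pos = let (b , b∈π , x∈b , y∈b) = countPair-pos⇒∃ π x y pos in
      ∃⇒countPair-pos x y (∈-filter⁺ _∈π? (fromB b b∈π) b∈π) x∈b y∈b
    B∩π⇒π : 0 < countPair (filter _∈π? B) x y → 0 < countPair π x y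
    B∩π⇒π pos = let (b , b∈ , x∈b , y∈b) = countPair-pos⇒∃ (filter _∈π? B) x y pos in
      ∃⇒countPair-pos x y (proj₂ (∈-filter⁻ _∈π? {xs = B} b∈)) x∈b y∈b
    ≤1-and-same-positivity⇒≡ : ∀ {a b} → a ≤ 1 → b ≤ 1 → (0 < a → 0 < b) → (0 < b → 0 < a) → a ≡ b
    ≤1-and-same-positivity⇒≡ z≤n       z≤n       _ _ = refl
    ≤1-and-same-positivity⇒≡ (s≤s z≤n) (s≤s z≤n) _ _ = refl
    ≤1-and-same-positivity⇒≡ z≤n       (s≤s z≤n) _ b⇒a with () ← b⇒a z<s
    ≤1-and-same-positivity⇒≡ (s≤s z≤n) z≤n       a⇒b _ with () ← a⇒b z<s

  gdd-pairs : ∀ x y → x ≢ y → countPair π x y + countPair B∖π x y ≡ 1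
  gdd-pairs x y x≢y = begin
    countPair π x y + countPair B∖π x y
      ≡⟨ cong (_+ countPair B∖π x y) (countPair-π≡countPair-B∩π x y x≢y) ⟩
    countPair (filter _∈π? B) x y + countPair B∖π x y ≡⟨ countPair-filter _∈π? B x y ⟨
    countPair B x y                                   ≡⟨ pairs x y x≢y ⟩
    1                                                 ∎
    where open ≡-Reasoning

  parallelClassGDD : GDD v k k (length π)
  parallelClassGDD = record
    { groups     = π
    ; blocks     = B∖π
    ; numGroups  = refl
    ; groupSize  = π-size
    ; groupsPart = partition
    ; blockSize  = anti-mono B∖π⊆B blockSize
    ; pairs      = gdd-pairs
    }

a≤⌈a/d⌉*d : ∀ a d → a ≤ ceilDiv a (suc d) * suc d
a≤⌈a/d⌉*d a d = +-cancelʳ-≤ d a _ (begin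
  a + d                                       ≡⟨ m≡m%n+[m/n]*n (a + d) (suc d) ⟩
  (a + d) % suc d + ceilDiv a (suc d) * suc d ≤⟨ +-monoˡ-≤ _ (s≤s⁻¹ (m%n<n (a + d) (suc d))) ⟩
  d + ceilDiv a (suc d) * suc d               ≡⟨ +-comm d _ ⟩
  ceilDiv a (suc d) * suc d + d               ∎)
  where open ≤-Reasoning

u≤⌈uk/k[k-1]⌉*[k-1] : ∀ u m → u ≤ ceilDiv (u * (2 + m)) ((2 + m) * suc m) * suc m
u≤⌈uk/k[k-1]⌉*[k-1] u m = *-cancelʳ-≤ u (q * suc m) (2 + m) (begin
  u * (2 + m)           ≤⟨ a≤⌈a/d⌉*d (u * (2 + m)) (m + suc m * suc m) ⟩
  q * ((2 + m) * suc m) ≡⟨ cong (q *_) (*-comm (2 + m) (suc m)) ⟩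
  q * (suc m * (2 + m)) ≡⟨ *-assoc q (suc m) (2 + m) ⟨
  q * suc m * (2 + m)   ∎)
  where
  open ≤-Reasoning
  q = ceilDiv (u * (2 + m)) ((2 + m) * suc m)

theorem3p9 : (v k : ℕ) → 2 ≤ k → (B : List (Subset v)) → IsBIBD v k B →
    (π : List (Subset v)) → IsParallelClass B π →
    Σ ℕ (λ u → u * k ≡ v × Σ (GDD v k k u) (λ Dπ →
      (χ : ℕ) → IsChromaticNumber B χ →
      Σ ℕ (λ χπ → IsChromaticNumber (GDD.blocks Dπ) χπ ×
        χπ ≤ χ × χ ≤ χπ + ceilDiv v (k * (k ∸ 1)))))
theorem3p9 v (suc (suc m)) 2≤k@(s≤s (s≤s z≤n)) B bibd π pc =
  length π , |π|*k≡v , parallelClassGDD , bounds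
  where
  open ParallelClassGDD bibd pc
  newColours = ceilDiv v ((2 + m) * suc m)

  |π|≤newColours*[k-1] : length π ≤ newColours * suc m
  |π|≤newColours*[k-1] = subst (λ w → length π ≤ ceilDiv w ((2 + m) * suc m) * suc m) |π|*k≡v
                           (u≤⌈uk/k[k-1]⌉*[k-1] (length π) m)

  bounds : (χ : ℕ) → IsChromaticNumber B χ →
           ∃[ χπ ] IsChromaticNumber B∖π χπ × χπ ≤ χ × χ ≤ χπ + newColours
  bounds χ (B-colourable , B-least) =
    let B∖π-colourable = colourable-anti-mono B∖π⊆B B-colourable
        (χπ , χπ-colourable , χπ-least) = chromaticNumber-exists B∖π B∖π-colourable
    in χπ , (χπ-colourable , χπ-least)
          , χπ-least χ B∖π-colourable
          , B-least _ (colourable-anti-mono B⊆π++B∖π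
                         (gdd-colourable parallelClassGDD 2≤k |π|≤newColours*[k-1] χπ-colourable))
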